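{- Let $T$ be a tree with at least three vertices. If $T$ is (isomorphic to) a general corona $T'\circ\mathcal{P}$ of some tree $T'$, then the domination subdivision number of $T$ equals $3$.
   Context: For a graph $T'$, a vertex neighborhood partition is a family $\mathcal{P}=\{\mathcal{P}(v): v\in V(T')\}$ where each $\mathcal{P}(v)$ is a partition of $N_{T'}(v)$ into nonempty parts. The general corona $T'\circ\mathcal{P}$ has vertex set $\{(v,1): v\in V(T')\}\cup\bigcup_{v\in V(T')}\{(v,A): A\in\mathcal{P}(v)\}$ and edge set $\bigcup_{v}\{(v,1)(v,A): A\in\mathcal{P}(v)\}\cup\bigcup_{uv\in E(T')}\{(v,A)(u,B): u\in A,\ v\in B\}$. The domination number $\gamma(G)$ is the minimum size of a dominating set (a set $D$ such that every vertex outside $D$ has a neighbor in $D$). Subdividing an edge $uv$ replaces it by a path $u,x,v$ with a new vertex $x$. The domination subdivision number $\mathrm{sd}(G)$ of a connected graph $G$ of order at least $3$ is the minimum number of edges that must be subdivided (each edge at most once) so that the domination number increases. -}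

module Defs where

open import Data.Nat using (ℕ; _≤_; _<_)
open import Data.Fin using (Fin)
open import Data.Product using (Σ; ∃; _×_; _,_; proj₁; proj₂; swap)
open import Data.Sum using (_⊎_; inj₁; inj₂)
open import Data.Empty using (⊥)
open import Data.List using (List; []; _∷_; _++_; length)
open import Data.List.Membership.Propositional using (_∈_)
open import Data.List.Relation.Unary.Unique.Propositional using (Unique)
open import Data.List.Relation.Unary.Linked using (Linked)
open import Relation.Nullary using (¬_)
open import Relation.Binary.PropositionalEquality using (_≡_; _≢_; refl; sym)
open import Function.Bundles using (_↔_; Inverse)

record Graph (V : Set) : Set₁ where
  field
    _~_   : V → V → Set
    ~-sym : ∀ {u v} → u ~ v → v ~ u
    ~-irr : ∀ {v} → ¬ (v ~ v)
open Graph public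

data Reach {V : Set} (G : Graph V) : V → V → Set where
  here  : ∀ {v} → Reach G v v
  step  : ∀ {u w v} → _~_ G u w → Reach G w v → Reach G u v

Connected : {V : Set} → Graph V → Set
Connected G = ∀ u v → Reach G u v

-- A cycle: distinct vertices x , m₁ … mₖ , y (k ≥ 1, so length ≥ 3),
-- consecutive ones adjacent, and y adjacent to x.
HasCycle : {V : Set} → Graph V → Set
HasCycle {V} G = Σ V λ x → Σ V λ y → Σ V λ m → Σ (List V) λ ms →
  Unique (x ∷ (m ∷ ms) ++ (y ∷ [])) ×
  Linked (_~_ G) (x ∷ (m ∷ ms) ++ (y ∷ [])) ×
  _~_ G y x

IsTree : {V : Set} → Graph V → Set
IsTree G = Connected G × ¬ HasCycle G

_≅_ : {V W : Set} → Graph V → Graph W → Set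
_≅_ {V} {W} G H = Σ (V ↔ W) λ f →
  ∀ u v → (_~_ G u v → _~_ H (Inverse.to f u) (Inverse.to f v)) ×
          (_~_ H (Inverse.to f u) (Inverse.to f v) → _~_ G u v)

-- P(v) is a partition of N(v) into k v nonempty parts, encoded by a
-- labelling lab v : V → Fin (k v) (only its values on N(v) matter)
-- such that every part (label) contains some neighbour of v.

record NbhdPartition {m : ℕ} (T : Graph (Fin m)) : Set where
  field
    parts    : Fin m → ℕ
    lab      : (v u : Fin m) → Fin (parts v)
    nonempty : ∀ v (A : Fin (parts v)) → ∃ λ u → _~_ T v u × lab v u ≡ A
open NbhdPartition public

CoronaV : {m : ℕ} {T : Graph (Fin m)} → NbhdPartition T → Set
CoronaV {m} P = Fin m ⊎ Σ (Fin m) λ v → Fin (parts P v)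

-- inj₁ v is (v,1); inj₂ (v , A) is (v,A).
CoronaAdj : {m : ℕ} {T : Graph (Fin m)} (P : NbhdPartition T) →
            CoronaV P → CoronaV P → Set
CoronaAdj P (inj₁ v) (inj₁ u) = ⊥
CoronaAdj P (inj₁ v) (inj₂ (w , A)) = v ≡ w
CoronaAdj P (inj₂ (w , A)) (inj₁ v) = v ≡ w
CoronaAdj {T = T} P (inj₂ (v , A)) (inj₂ (u , B)) =
  _~_ T u v × lab P v u ≡ A × lab P u v ≡ B

corona : {m : ℕ} (T : Graph (Fin m)) (P : NbhdPartition T) → Graph (CoronaV P)
corona T P = record { _~_ = CoronaAdj P ; ~-sym = s ; ~-irr = i }
  where
  s : ∀ {x y} → CoronaAdj P x y → CoronaAdj P y x
  s {inj₁ v} {inj₁ u} ()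
  s {inj₁ v} {inj₂ _} e = e
  s {inj₂ _} {inj₁ v} e = e
  s {inj₂ _} {inj₂ _} (a , b , c) = ~-sym T a , c , b
  i : ∀ {x} → ¬ CoronaAdj P x x
  i {inj₁ v} ()
  i {inj₂ _} (a , _) = ~-irr T a

Dominating : {V : Set} → Graph V → List V → Set
Dominating {V} G D = ∀ v → v ∈ D ⊎ (∃ λ u → u ∈ D × _~_ G u v)

IsDomNumber : {V : Set} → Graph V → ℕ → Set
IsDomNumber G k =
  (∃ λ D → Unique D × Dominating G D × length D ≡ k) ×
  (∀ D → Unique D → Dominating G D → k ≤ length D)

ValidEdgeFamily : {V : Set} (G : Graph V) {k : ℕ} → (Fin k → V × V) → Set
ValidEdgeFamily G {k} es =
  (∀ i → _~_ G (proj₁ (es i)) (proj₂ (es i))) ×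
  (∀ i j → i ≢ j → es i ≢ es j × es i ≢ swap (es j))

SubdAdj : {V : Set} (G : Graph V) {k : ℕ} → (Fin k → V × V) →
          V ⊎ Fin k → V ⊎ Fin k → Set
SubdAdj G es (inj₁ u) (inj₁ v) =
  _~_ G u v × (∀ i → es i ≢ (u , v) × es i ≢ (v , u))
SubdAdj G es (inj₁ u) (inj₂ i) = proj₁ (es i) ≡ u ⊎ proj₂ (es i) ≡ u
SubdAdj G es (inj₂ i) (inj₁ u) = proj₁ (es i) ≡ u ⊎ proj₂ (es i) ≡ u
SubdAdj G es (inj₂ i) (inj₂ j) = ⊥

subdivide : {V : Set} (G : Graph V) {k : ℕ} → (Fin k → V × V) → Graph (V ⊎ Fin k)
subdivide G {k} es = record { _~_ = SubdAdj G es ; ~-sym = s ; ~-irr = i }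
  where
  s : ∀ {x y} → SubdAdj G es x y → SubdAdj G es y x
  s {inj₁ u} {inj₁ v} (a , b) = ~-sym G a , λ j → proj₂ (b j) , proj₁ (b j)
  s {inj₁ u} {inj₂ _} e = e
  s {inj₂ _} {inj₁ u} e = e
  s {inj₂ _} {inj₂ _} ()
  i : ∀ {x} → ¬ SubdAdj G es x x
  i {inj₁ u} (a , _) = ~-irr G a
  i {inj₂ _} ()

DomIncreases : {V : Set} (G : Graph V) {k : ℕ} → (Fin k → V × V) → Set
DomIncreases G es = ∃ λ a → ∃ λ b →
  IsDomNumber G a × IsDomNumber (subdivide G es) b × a < b

IsSdNumber : {V : Set} → Graph V → ℕ → Set
IsSdNumber {V} G s =
  (Σ (Fin s → V × V) λ es → ValidEdgeFamily G es × DomIncreases G es) ×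
  (∀ k → k < s → (es : Fin k → V × V) → ValidEdgeFamily G es →
     ¬ DomIncreases G es)

-- In the corona T′ ∘ P (T′ of order m) the closed neighbourhoods of the centres (v,1) are disjoint
-- and every dominating set meets each of them, so γ = m.  Subdividing the three edges of a path
-- (u,1) (u,B) (v,A) (v,1) over an edge uv of T′ adds a further disjoint closed neighbourhood, that of
-- the middle subdivision vertex, so γ rises to m + 1.  If at most two edges are subdivided, they lie
-- near at most two vertices a, b of T′; orient T′ towards a and b and let every v pick either (v,1) or
-- the part (v,A) containing the vertex it points to (or the subdivision vertex on that spoke).  Parts
-- not picked are dominated through the cross edges from the vertices pointing at them, so γ stays m.
-- Domination and subdivision numbers are invariant under isomorphism, hence sd(T) = 3.
module Submission where

open import Defs
open import Data.Bool using (Bool; true; false; if_then_else_)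
open import Data.Empty using (⊥; ⊥-elim)
open import Data.Fin using (Fin; _≟_) renaming (zero to f0; suc to fs)
open import Data.Fin.Properties using (any?; injective⇒≤)
open import Data.List using (List; []; _∷_; _++_; length; map; allFin; lookup)
open import Data.List.Membership.Propositional using (_∈_; _∉_)
open import Data.List.Membership.Propositional.Properties using (∈-map⁺; ∈-map⁻; ∈-allFin)
open import Data.List.Properties using (length-map; length-tabulate)
open import Data.List.Relation.Unary.All using (All) renaming ([] to []ᴬ)
open import Data.List.Relation.Unary.All.Properties using (¬Any⇒All¬)
open import Data.List.Relation.Unary.AllPairs using ([]; _∷_)
open import Data.List.Relation.Unary.Any using (here; there; index)
open import Data.List.Relation.Unary.Any.Properties using (lookup-index)
open import Data.List.Relation.Unary.Linked using (Linked; [-]; _∷_)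
open import Data.List.Relation.Unary.Unique.Propositional using (Unique)
import Data.List.Relation.Unary.Unique.Propositional.Properties as Unique
open import Data.Maybe using (Maybe; just; nothing)
open import Data.Maybe.Properties using (just-injective)
open import Data.Nat using (ℕ; suc; _≤_; _<_; s≤s)
open import Data.Nat.Properties using (≤-trans; <⇒≱; n<1+n)
open import Data.Product using (Σ; ∃; _×_; _,_; proj₁; proj₂; swap)
import Data.Product.Properties as Product
open import Data.Sum using (_⊎_; inj₁; inj₂; [_,_]′) renaming (map to ⊎-map; swap to ⊎-swap; map₁ to ⊎-map₁; map₂ to ⊎-map₂)
import Data.Sum.Properties as Sum
open import Function using (_∘′_)
open import Function.Bundles using (Inverse)
open import Relation.Binary.Definitions using (DecidableEquality)
open import Relation.Binary.PropositionalEquality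
open import Relation.Nullary using (¬_; Dec; yes; no; does)

record Iso {V W : Set} (G : Graph V) (H : Graph W) : Set where
  field
    to       : V → W
    from     : W → V
    from-to  : ∀ x → from (to x) ≡ x
    to-from  : ∀ y → to (from y) ≡ y
    to-adj   : ∀ {u v} → _~_ G u v → _~_ H (to u) (to v)
    from-adj : ∀ {x y} → _~_ H x y → _~_ G (from x) (from y)

  to-injective : ∀ {x y} → to x ≡ to y → x ≡ y
  to-injective {x} {y} e = trans (sym (from-to x)) (trans (cong from e) (from-to y))

open Iso

Iso-sym : ∀ {V W} {G : Graph V} {H : Graph W} → Iso G H → Iso H G
Iso-sym I = record
  { to = from I ; from = to I ; from-to = to-from I ; to-from = from-to I
  ; to-adj = from-adj I ; from-adj = to-adj I }

≅⇒Iso : ∀ {V W} {G : Graph V} {H : Graph W} → G ≅ H → Iso G H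
≅⇒Iso {H = H} (f , adj) = record
  { to = Inverse.to f ; from = Inverse.from f
  ; from-to = Inverse.strictlyInverseʳ f ; to-from = Inverse.strictlyInverseˡ f
  ; to-adj = λ {u} {v} → proj₁ (adj u v)
  ; from-adj = λ {x} {y} e → proj₂ (adj (Inverse.from f x) (Inverse.from f y))
      (subst₂ (_~_ H) (sym (Inverse.strictlyInverseˡ f x)) (sym (Inverse.strictlyInverseˡ f y)) e) }

module _ {V W : Set} {G : Graph V} {H : Graph W} (I : Iso G H) where

  Dominating-map : ∀ {D} → Dominating G D → Dominating H (map (to I) D)
  Dominating-map {D} dom w with dom (from I w)
  ... | inj₁ w∈D = inj₁ (subst (_∈ map (to I) D) (to-from I w) (∈-map⁺ (to I) w∈D))
  ... | inj₂ (u , u∈D , u~w) =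
    inj₂ (to I u , ∈-map⁺ (to I) u∈D , subst (_~_ H (to I u)) (to-from I w) (to-adj I u~w))

  Unique-map : ∀ {D} → Unique D → Unique (map (to I) D)
  Unique-map = Unique.map⁺ (to-injective I)

IsDomNumber-transport : ∀ {V W} {G : Graph V} {H : Graph W} → Iso G H →
                        ∀ {k} → IsDomNumber G k → IsDomNumber H k
IsDomNumber-transport I ((D , uniq , dom , len) , minimal) =
  (map (to I) D , Unique-map I uniq , Dominating-map I dom , trans (length-map (to I) D) len) ,
  λ D′ uniq′ dom′ → subst (_ ≤_) (length-map (from I) D′)
    (minimal (map (from I) D′) (Unique-map (Iso-sym I) uniq′) (Dominating-map (Iso-sym I) dom′))

module SubdivisionIso {V W : Set} {G : Graph V} {H : Graph W} (I : Iso G H) {k : ℕ}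
  (esG : Fin k → V × V) (esH : Fin k → W × W)
  (es-image : ∀ i → esH i ≡ (to I (proj₁ (esG i)) , to I (proj₂ (esG i)))) where

  private
    fst-image : ∀ i → proj₁ (esH i) ≡ to I (proj₁ (esG i))
    fst-image i = cong proj₁ (es-image i)

    snd-image : ∀ i → proj₂ (esH i) ≡ to I (proj₂ (esG i))
    snd-image i = cong proj₂ (es-image i)

    edge-preimage : ∀ i {u v} → esH i ≡ (to I u , to I v) → esG i ≡ (u , v)
    edge-preimage i e = cong₂ _,_
      (to-injective I (trans (sym (fst-image i)) (cong proj₁ e)))
      (to-injective I (trans (sym (snd-image i)) (cong proj₂ e)))

    edge-image : ∀ i {x y} → esG i ≡ (from I x , from I y) → esH i ≡ (x , y)
    edge-image i e = trans (es-image i) (cong₂ _,_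
      (trans (cong (to I) (cong proj₁ e)) (to-from I _))
      (trans (cong (to I) (cong proj₂ e)) (to-from I _)))

    end-image : ∀ i u → proj₁ (esG i) ≡ u ⊎ proj₂ (esG i) ≡ u →
                proj₁ (esH i) ≡ to I u ⊎ proj₂ (esH i) ≡ to I u
    end-image i u (inj₁ e) = inj₁ (trans (fst-image i) (cong (to I) e))
    end-image i u (inj₂ e) = inj₂ (trans (snd-image i) (cong (to I) e))

    end-preimage : ∀ i x → proj₁ (esH i) ≡ x ⊎ proj₂ (esH i) ≡ x →
                   proj₁ (esG i) ≡ from I x ⊎ proj₂ (esG i) ≡ from I x
    end-preimage i x (inj₁ e) = inj₁ (trans (sym (from-to I _)) (cong (from I) (trans (sym (fst-image i)) e)))
    end-preimage i x (inj₂ e) = inj₂ (trans (sym (from-to I _)) (cong (from I) (trans (sym (snd-image i)) e)))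

    to′ : V ⊎ Fin k → W ⊎ Fin k
    to′ (inj₁ v) = inj₁ (to I v)
    to′ (inj₂ i) = inj₂ i

    from′ : W ⊎ Fin k → V ⊎ Fin k
    from′ (inj₁ w) = inj₁ (from I w)
    from′ (inj₂ i) = inj₂ i

    to′-adj : ∀ {x y} → SubdAdj G esG x y → SubdAdj H esH (to′ x) (to′ y)
    to′-adj {inj₁ u} {inj₁ v} (u~v , kept) =
      to-adj I u~v , λ i → (λ e → proj₁ (kept i) (edge-preimage i e)) , (λ e → proj₂ (kept i) (edge-preimage i e))
    to′-adj {inj₁ u} {inj₂ i} e = end-image i u e
    to′-adj {inj₂ i} {inj₁ u} e = end-image i u e

    from′-adj : ∀ {x y} → SubdAdj H esH x y → SubdAdj G esG (from′ x) (from′ y)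
    from′-adj {inj₁ u} {inj₁ v} (u~v , kept) =
      from-adj I u~v , λ i → (λ e → proj₁ (kept i) (edge-image i e)) , (λ e → proj₂ (kept i) (edge-image i e))
    from′-adj {inj₁ u} {inj₂ i} e = end-preimage i u e
    from′-adj {inj₂ i} {inj₁ u} e = end-preimage i u e

    from′-to′ : ∀ x → from′ (to′ x) ≡ x
    from′-to′ (inj₁ v) = cong inj₁ (from-to I v)
    from′-to′ (inj₂ i) = refl

    to′-from′ : ∀ x → to′ (from′ x) ≡ x
    to′-from′ (inj₁ w) = cong inj₁ (to-from I w)
    to′-from′ (inj₂ i) = refl

  subdivide-iso : Iso (subdivide G esG) (subdivide H esH)
  subdivide-iso = record
    { to = to′ ; from = from′ ; from-to = from′-to′ ; to-from = to′-from′
    ; to-adj = to′-adj ; from-adj = from′-adj }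

  ValidEdgeFamily-transport : ValidEdgeFamily G esG → ValidEdgeFamily H esH
  ValidEdgeFamily-transport (edges , distinct) =
    (λ i → subst₂ (_~_ H) (sym (fst-image i)) (sym (snd-image i)) (to-adj I (edges i))) ,
    λ i j i≢j → (λ e → proj₁ (distinct i j i≢j) (edge-preimage i (trans e (es-image j))))
              , (λ e → proj₂ (distinct i j i≢j) (edge-preimage i (trans e (cong swap (es-image j)))))

  DomIncreases-transport : DomIncreases G esG → DomIncreases H esH
  DomIncreases-transport (a , b , γa , γb , a<b) =
    a , b , IsDomNumber-transport I γa , IsDomNumber-transport subdivide-iso γb , a<b

IsSdNumber-transport : ∀ {V W} {G : Graph V} {H : Graph W} → Iso G H →
                       ∀ {s} → IsSdNumber H s → IsSdNumber G s
IsSdNumber-transport {V} {W} I ((esH , validH , increasesH) , fewH) =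
  (preimage esH , back.ValidEdgeFamily-transport validH , back.DomIncreases-transport increasesH) ,
  λ k k<s es valid increases → let module forth = SubdivisionIso I es (image es) (λ _ → refl) in
    fewH k k<s (image es) (forth.ValidEdgeFamily-transport valid) (forth.DomIncreases-transport increases)
  where
  image : ∀ {k} → (Fin k → V × V) → Fin k → W × W
  image es i = to I (proj₁ (es i)) , to I (proj₂ (es i))
  preimage : ∀ {k} → (Fin k → W × W) → Fin k → V × V
  preimage es i = from I (proj₁ (es i)) , from I (proj₂ (es i))
  module back = SubdivisionIso (Iso-sym I) esH (preimage esH) (λ _ → refl)

onto⇒≤length : ∀ {X : Set} {K : ℕ} (o : X → Fin K) (D : List X) →
               (∀ j → ∃ λ x → x ∈ D × o x ≡ j) → K ≤ length D
onto⇒≤length o D hit = injective⇒≤ {f = position} position-injective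
  where
  position : _ → Fin (length D)
  position j = index (proj₁ (proj₂ (hit j)))

  o-at : ∀ j → o (lookup D (position j)) ≡ j
  o-at j with hit j
  ... | x , x∈D , ox≡j = trans (cong o (sym (lookup-index x∈D))) ox≡j

  position-injective : ∀ {i j} → position i ≡ position j → i ≡ j
  position-injective {i} {j} e = trans (sym (o-at i)) (trans (cong (o ∘′ lookup D) e) (o-at j))

record Orientation {m : ℕ} (T : Graph (Fin m)) (r : Fin m) : Set where
  field
    parent        : Fin m → Fin m
    parent-root   : parent r ≡ r
    edge-oriented : ∀ {u w} → _~_ T u w → parent u ≡ w ⊎ parent w ≡ u

  parent-of-root-neighbour : ∀ {w} → _~_ T r w → parent w ≡ r
  parent-of-root-neighbour {w} r~w with edge-oriented r~w
  ... | inj₂ e = e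
  ... | inj₁ e = ⊥-elim (~-irr T (subst (_~_ T r) (trans (sym e) parent-root) r~w))

∉⇒All≢ : ∀ {A : Set} {x : A} {xs} → x ∉ xs → All (x ≢_) xs
∉⇒All≢ = ¬Any⇒All¬ _

All≢⇒∉ : ∀ {A : Set} {x : A} {xs} → All (x ≢_) xs → x ∉ xs
All≢⇒∉ x≢xs x∈xs = Data.List.Relation.Unary.All.lookup x≢xs x∈xs refl

~⇒≢ : ∀ {V} (G : Graph V) {u w} → _~_ G u w → u ≢ w
~⇒≢ G u~w refl = ~-irr G u~w

module Tree {m : ℕ} (T : Graph (Fin m)) (tree : IsTree T) where
  open import Data.List.Membership.DecPropositional (_≟_ {m}) using (_∈?_)

  private
    V : Set
    V = Fin m

    Walk : V → V → Set
    Walk = Reach T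

  vertices : ∀ {u v} → Walk u v → List V
  vertices (here {v}) = v ∷ []
  vertices (step {u} _ w) = u ∷ vertices w

  IsPath : ∀ {u v} → Walk u v → Set
  IsPath w = Unique (vertices w)

  _++ʷ_ : ∀ {u w v} → Walk u w → Walk w v → Walk u v
  here ++ʷ s = s
  step e r ++ʷ s = step e (r ++ʷ s)

  ∈-++ʷ : ∀ {u w v x} (r : Walk u w) (s : Walk w v) →
          x ∈ vertices (r ++ʷ s) → x ∈ vertices r ⊎ x ∈ vertices s
  ∈-++ʷ here s x∈ = inj₂ x∈
  ∈-++ʷ (step e r) s (here x≡) = inj₁ (here x≡)
  ∈-++ʷ (step e r) s (there x∈) = ⊎-map₁ there (∈-++ʷ r s x∈)

  source∈ : ∀ {u v} (r : Walk u v) → u ∈ vertices r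
  source∈ here = here refl
  source∈ (step e r) = here refl

  target∈ : ∀ {u v} (r : Walk u v) → v ∈ vertices r
  target∈ here = here refl
  target∈ (step e r) = there (target∈ r)

  reverse : ∀ {u v} → Walk u v → Walk v u
  reverse here = here
  reverse (step e r) = reverse r ++ʷ step (~-sym T e) here

  ∈-reverse : ∀ {u v x} (r : Walk u v) → x ∈ vertices (reverse r) → x ∈ vertices r
  ∈-reverse here x∈ = x∈
  ∈-reverse (step e r) x∈ with ∈-++ʷ (reverse r) (step (~-sym T e) here) x∈
  ... | inj₁ x∈r = there (∈-reverse r x∈r)
  ... | inj₂ (here x≡) = there (subst (_∈ vertices r) (sym x≡) (source∈ r))
  ... | inj₂ (there (here x≡)) = here x≡

  drop-to : ∀ {u v x} (r : Walk u v) → x ∈ vertices r → Walk x v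
  drop-to here (here refl) = here
  drop-to (step e r) (here refl) = step e r
  drop-to (step e r) (there x∈) = drop-to r x∈

  ∈-drop-to : ∀ {u v x y} (r : Walk u v) (x∈ : x ∈ vertices r) →
              y ∈ vertices (drop-to r x∈) → y ∈ vertices r
  ∈-drop-to here (here refl) y∈ = y∈
  ∈-drop-to (step e r) (here refl) y∈ = y∈
  ∈-drop-to (step e r) (there x∈) y∈ = there (∈-drop-to r x∈ y∈)

  drop-to-path : ∀ {u v x} (r : Walk u v) (x∈ : x ∈ vertices r) → IsPath r → IsPath (drop-to r x∈)
  drop-to-path here (here refl) p = p
  drop-to-path (step e r) (here refl) p = p
  drop-to-path (step e r) (there x∈) (_ ∷ p) = drop-to-path r x∈ p

  take-to : ∀ {u v x} (r : Walk u v) → x ∈ vertices r → Walk u x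
  take-to here (here refl) = here
  take-to (step e r) (here refl) = here
  take-to (step e r) (there x∈) = step e (take-to r x∈)

  ∈-take-to : ∀ {u v x y} (r : Walk u v) (x∈ : x ∈ vertices r) →
              y ∈ vertices (take-to r x∈) → y ∈ vertices r
  ∈-take-to here (here refl) y∈ = y∈
  ∈-take-to (step e r) (here refl) (here y≡) = here y≡
  ∈-take-to (step e r) (there x∈) (here y≡) = here y≡
  ∈-take-to (step e r) (there x∈) (there y∈) = there (∈-take-to r x∈ y∈)

  take-to-path : ∀ {u v x} (r : Walk u v) (x∈ : x ∈ vertices r) → IsPath r → IsPath (take-to r x∈)
  take-to-path here (here refl) p = p
  take-to-path (step e r) (here refl) p = []ᴬ ∷ []
  take-to-path (step e r) (there x∈) (u∉ ∷ p) =
    ∉⇒All≢ (λ u∈ → All≢⇒∉ u∉ (∈-take-to r x∈ u∈)) ∷ take-to-path r x∈ p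

  shortcut : ∀ {u v} (r : Walk u v) →
             Σ (Walk u v) λ s → IsPath s × (∀ {x} → x ∈ vertices s → x ∈ vertices r)
  shortcut here = here , []ᴬ ∷ [] , λ x∈ → x∈
  shortcut (step {u} e r) with shortcut r
  ... | s , path , s⊆r with u ∈? vertices s
  ...   | yes u∈s = drop-to s u∈s , drop-to-path s u∈s path , λ x∈ → there (s⊆r (∈-drop-to s u∈s x∈))
  ...   | no u∉s = step e s , ∉⇒All≢ u∉s ∷ path , λ { (here x≡) → here x≡ ; (there x∈) → there (s⊆r x∈) }

  _++ʷ-path_ : ∀ {u v w} (r : Walk u v) → IsPath r → w ∉ vertices r → (e : _~_ T v w) →
               IsPath (r ++ʷ step e here)
  _++ʷ-path_ here p w∉ e = ∉⇒All≢ (λ { (here x≡) → w∉ (here (sym x≡)) ; (there ()) }) ∷ []ᴬ ∷ []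
  _++ʷ-path_ (step {u} e′ r) (u∉ ∷ p) w∉ e =
    ∉⇒All≢ u∉r+w ∷ _++ʷ-path_ r p (λ w∈ → w∉ (there w∈)) e
    where
    u∉r+w : u ∉ vertices (r ++ʷ step e here)
    u∉r+w u∈ with ∈-++ʷ r (step e here) u∈
    ... | inj₁ u∈r = All≢⇒∉ u∉ u∈r
    ... | inj₂ (here refl) = All≢⇒∉ u∉ (target∈ r)
    ... | inj₂ (there (here refl)) = w∉ (here refl)

  vertices-linked : ∀ {u v} (r : Walk u v) → Linked (_~_ T) (vertices r)
  vertices-linked here = [-]
  vertices-linked (step e here) = e ∷ [-]
  vertices-linked (step e (step e′ r)) = e ∷ vertices-linked (step e′ r)

  vertices-snoc : ∀ {u v} (r : Walk u v) → Σ (List V) λ xs → vertices r ≡ xs ++ (v ∷ [])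
  vertices-snoc here = [] , refl
  vertices-snoc (step {u} e r) with vertices-snoc r
  ... | xs , eq = u ∷ xs , cong (u ∷_) eq

  path-closes-cycle : ∀ {x y} (a : V) (r : Walk x y) → IsPath r → a ∉ vertices r → x ≢ y →
                      _~_ T a x → _~_ T y a → HasCycle T
  path-closes-cycle a here _ _ x≢y _ _ = ⊥-elim (x≢y refl)
  path-closes-cycle {x} {y} a (step e r) path a∉ _ a~x y~a with vertices-snoc r
  ... | xs , eq = a , y , x , xs ,
    subst (λ l → Unique (a ∷ x ∷ l)) eq (∉⇒All≢ a∉ ∷ path) ,
    subst (λ l → Linked (_~_ T) (a ∷ x ∷ l)) eq (a~x ∷ vertices-linked (step e r)) ,
    y~a

  acyclic : ¬ HasCycle T
  acyclic = proj₂ tree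

  next : ∀ {u v} → Walk u v → V
  next (here {v}) = v
  next (step {w = w} _ _) = w

  next-of-closed-path : ∀ {v} (r : Walk v v) → IsPath r → next r ≡ v
  next-of-closed-path here _ = refl
  next-of-closed-path (step e r) (v∉ ∷ _) = ⊥-elim (All≢⇒∉ v∉ (target∈ r))

  -- Two paths with the same ends leaving by different edges would close a cycle.
  next-unique : ∀ {u t} (r s : Walk u t) → IsPath r → IsPath s → next r ≡ next s
  next-unique here here _ _ = refl
  next-unique here (step e s) _ (u∉ ∷ _) = ⊥-elim (All≢⇒∉ u∉ (target∈ s))
  next-unique (step e r) here (u∉ ∷ _) _ = ⊥-elim (All≢⇒∉ u∉ (target∈ r))
  next-unique {u} (step {w = x} u~x r) (step {w = y} u~y s) (u∉r ∷ _) (u∉s ∷ _) with x ≟ y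
  ... | yes x≡y = x≡y
  ... | no x≢y with shortcut (r ++ʷ reverse s)
  ...   | c , path , c⊆ = ⊥-elim (acyclic (path-closes-cycle u c path u∉c x≢y u~x (~-sym T u~y)))
    where
    u∉c : u ∉ vertices c
    u∉c u∈ with ∈-++ʷ r (reverse s) (c⊆ u∈)
    ... | inj₁ u∈r = All≢⇒∉ u∉r u∈r
    ... | inj₂ u∈s = All≢⇒∉ u∉s (∈-reverse s u∈s)

  next-is-neighbour-on-path : ∀ {u w t} (r : Walk w t) → IsPath r → u ∈ vertices r →
                              _~_ T u w → next r ≡ u
  next-is-neighbour-on-path here _ (here refl) u~w = ⊥-elim (~-irr T u~w)
  next-is-neighbour-on-path (step e r) _ (here refl) u~w = ⊥-elim (~-irr T u~w)
  next-is-neighbour-on-path {u} {w} (step {w = x} w~x r) (w∉ ∷ path) (there u∈) u~w with x ≟ u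
  ... | yes x≡u = x≡u
  ... | no x≢u = ⊥-elim (acyclic (path-closes-cycle w (take-to r u∈) (take-to-path r u∈ path)
                   (λ w∈ → All≢⇒∉ w∉ (∈-take-to r u∈ w∈)) x≢u w~x u~w))

  next-oriented : ∀ {u w t} (r : Walk u t) (s : Walk w t) → IsPath r → IsPath s → _~_ T u w →
                  next r ≡ w ⊎ next s ≡ u
  next-oriented r s r-path s-path u~w with _ ∈? vertices s
  ... | yes u∈s = inj₂ (next-is-neighbour-on-path s s-path u∈s u~w)
  ... | no u∉s = inj₁ (next-unique r (step u~w s) r-path (∉⇒All≢ u∉s ∷ s-path))

  -- Extend the path by the edge z w, or cut it at w if it already passes through w.
  next-retarget : ∀ {c z w} (r : Walk c z) → IsPath r → _~_ T z w → c ≢ z → c ≢ w →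
                  Σ (Walk c w) λ r′ → IsPath r′ × next r′ ≡ next r
  next-retarget {w = w} r r-path z~w c≢z c≢w with w ∈? vertices r
  next-retarget here _ _ c≢z _ | _ = ⊥-elim (c≢z refl)
  next-retarget (step e r) _ _ _ c≢w | yes (here w≡c) = ⊥-elim (c≢w (sym w≡c))
  next-retarget (step e r) (c∉ ∷ r-path) _ _ _ | yes (there w∈) =
    step e (take-to r w∈) , ∉⇒All≢ (λ c∈ → All≢⇒∉ c∉ (∈-take-to r w∈ c∈)) ∷ take-to-path r w∈ r-path ,
    refl
  next-retarget (step e r) r-path z~w _ _ | no w∉ =
    step e r ++ʷ step z~w here , _++ʷ-path_ (step e r) r-path w∉ z~w , refl

  path-to : (u r : V) → Σ (Walk u r) IsPath
  path-to u r = let (s , path , _) = shortcut (proj₁ tree u r) in s , path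

  parent-towards : V → V → V
  parent-towards r u = next (proj₁ (path-to u r))

  orientation : (r : V) → Orientation T r
  orientation r = record
    { parent = parent-towards r
    ; parent-root = next-of-closed-path (proj₁ (path-to r r)) (proj₂ (path-to r r))
    ; edge-oriented = λ {u} {w} → next-oriented (proj₁ (path-to u r)) (proj₁ (path-to w r))
                                    (proj₂ (path-to u r)) (proj₂ (path-to w r)) }

  parent-towards-neighbour : ∀ {z w c} → _~_ T z w → c ≢ z → c ≢ w →
                             parent-towards z c ≡ parent-towards w c
  parent-towards-neighbour {z} {w} {c} z~w c≢z c≢w =
    let (r′ , r′-path , same) = next-retarget (proj₁ (path-to c z)) (proj₂ (path-to c z)) z~w c≢z c≢w
    in trans (sym same) (next-unique r′ (proj₁ (path-to c w)) r′-path (proj₂ (path-to c w)))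

module Corona {m : ℕ} (T : Graph (Fin m)) (P : NbhdPartition T) where

  CV : Set
  CV = CoronaV P

  C : Graph CV
  C = corona T P

  L : (v : Fin m) → Fin m → Fin (parts P v)
  L = lab P

  centre : Fin m → CV
  centre v = inj₁ v

  part : (v : Fin m) → Fin (parts P v) → CV
  part v A = inj₂ (v , A)

  _≟ᶜ_ : DecidableEquality CV
  _≟ᶜ_ = Sum.≡-dec _≟_ (Product.≡-dec _≟_ _≟_)

  _≟ᵉ_ : DecidableEquality (CV × CV)
  _≟ᵉ_ = Product.≡-dec _≟ᶜ_ _≟ᶜ_

  owner : CV → Fin m
  owner (inj₁ v) = v
  owner (inj₂ (v , _)) = v

  length-allFin : length (allFin m) ≡ m
  length-allFin = length-tabulate (λ i → i)

  centres : List CV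
  centres = map centre (allFin m)

  -- A dominating set must meet every closed neighbourhood of a centre, and these are disjoint.
  γ-corona : IsDomNumber C m
  γ-corona =
    (centres , Unique.map⁺ (λ { refl → refl }) (Unique.allFin⁺ m) , dominating ,
     trans (length-map centre (allFin m)) length-allFin) ,
    λ D _ dom → onto⇒≤length owner D (meets D dom)
    where
    dominating : Dominating C centres
    dominating (inj₁ v) = inj₁ (∈-map⁺ centre (∈-allFin v))
    dominating (inj₂ (v , A)) = inj₂ (centre v , ∈-map⁺ centre (∈-allFin v) , refl)

    meets : ∀ D → Dominating C D → ∀ v → ∃ λ x → x ∈ D × owner x ≡ v
    meets D dom v with dom (centre v)
    ... | inj₁ v∈D = centre v , v∈D , refl
    ... | inj₂ (inj₂ (w , A) , x∈D , v≡w) = inj₂ (w , A) , x∈D , sym v≡w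

  module Subdivided {k : ℕ} (es : Fin k → CV × CV) where

    H : Graph (CV ⊎ Fin k)
    H = subdivide C es

    IsSpoke : (u : Fin m) → Fin (parts P u) → Fin k → Set
    IsSpoke u A i = es i ≡ (centre u , part u A) ⊎ es i ≡ (part u A , centre u)

    isSpoke? : ∀ u A i → Dec (IsSpoke u A i)
    isSpoke? u A i with es i ≟ᵉ (centre u , part u A) | es i ≟ᵉ (part u A , centre u)
    ... | yes e | _ = yes (inj₁ e)
    ... | no _ | yes e = yes (inj₂ e)
    ... | no e₁ | no e₂ = no λ { (inj₁ e) → e₁ e ; (inj₂ e) → e₂ e }

    NoSpoke : (u : Fin m) → Fin (parts P u) → Set
    NoSpoke u A = ∀ i → ¬ IsSpoke u A i

    IsCross : Fin m → Fin m → Fin k → Set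
    IsCross x y i = es i ≡ (part x (L x y) , part y (L y x)) ⊎ es i ≡ (part y (L y x) , part x (L x y))

    centre~spoke : ∀ {u A i} → IsSpoke u A i → SubdAdj C es (inj₁ (centre u)) (inj₂ i)
    centre~spoke (inj₁ e) = inj₁ (cong proj₁ e)
    centre~spoke (inj₂ e) = inj₂ (cong proj₂ e)

    part~spoke : ∀ {u A i} → IsSpoke u A i → SubdAdj C es (inj₁ (part u A)) (inj₂ i)
    part~spoke (inj₁ e) = inj₂ (cong proj₂ e)
    part~spoke (inj₂ e) = inj₁ (cong proj₁ e)

    owner-spoke : ∀ {u A i} → IsSpoke u A i → owner (proj₁ (es i)) ≡ u
    owner-spoke (inj₁ e) = cong (owner ∘′ proj₁) e
    owner-spoke (inj₂ e) = cong (owner ∘′ proj₁) e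

    centre~part : ∀ {u A} → NoSpoke u A → SubdAdj C es (inj₁ (centre u)) (inj₁ (part u A))
    centre~part no-spoke = refl , λ i → (λ e → no-spoke i (inj₁ e)) , (λ e → no-spoke i (inj₂ e))

    part~centre : ∀ {u A} → NoSpoke u A → SubdAdj C es (inj₁ (part u A)) (inj₁ (centre u))
    part~centre no-spoke = refl , λ i → (λ e → no-spoke i (inj₂ e)) , (λ e → no-spoke i (inj₁ e))

    owner′ : CV ⊎ Fin k → Fin m
    owner′ (inj₁ x) = owner x
    owner′ (inj₂ i) = owner (proj₁ (es i))

    spoke-determined : ∀ {u A u′ A′ i} → IsSpoke u A i → IsSpoke u′ A′ i →
                       _≡_ {A = Σ (Fin m) (Fin ∘′ parts P)} (u , A) (u′ , A′)
    spoke-determined (inj₁ e) (inj₁ e′) with trans (sym e) e′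
    ... | refl = refl
    spoke-determined (inj₁ e) (inj₂ e′) with trans (sym e) e′
    ... | ()
    spoke-determined (inj₂ e) (inj₁ e′) with trans (sym e) e′
    ... | ()
    spoke-determined (inj₂ e) (inj₂ e′) with trans (sym e) e′
    ... | refl = refl

    spoke-centre-unique : ∀ {u A u′ A′ i} → IsSpoke u A i → IsSpoke u′ A′ i → u ≡ u′
    spoke-centre-unique s s′ = cong proj₁ (spoke-determined s s′)

    spoke≢cross : ∀ {u A x y i} → IsSpoke u A i → IsCross x y i → ⊥
    spoke≢cross (inj₁ e) (inj₁ e′) with trans (sym e) e′
    ... | ()
    spoke≢cross (inj₁ e) (inj₂ e′) with trans (sym e) e′
    ... | ()
    spoke≢cross (inj₂ e) (inj₁ e′) with trans (sym e) e′
    ... | ()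
    spoke≢cross (inj₂ e) (inj₂ e′) with trans (sym e) e′
    ... | ()

    cross-sym : ∀ {x y i} → IsCross x y i → IsCross y x i
    cross-sym (inj₁ e) = inj₂ e
    cross-sym (inj₂ e) = inj₁ e

    owners : CV × CV → Fin m × Fin m
    owners (x , y) = owner x , owner y

    cross-determined : ∀ {x y x′ y′ i} → IsCross x y i → IsCross x′ y′ i →
                       (x ≡ x′ × y ≡ y′) ⊎ (x ≡ y′ × y ≡ x′)
    cross-determined (inj₁ e) (inj₁ e′) with cong owners (trans (sym e) e′)
    ... | refl = inj₁ (refl , refl)
    cross-determined (inj₁ e) (inj₂ e′) with cong owners (trans (sym e) e′)
    ... | refl = inj₂ (refl , refl)
    cross-determined (inj₂ e) (inj₁ e′) with cong owners (trans (sym e) e′)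
    ... | refl = inj₂ (refl , refl)
    cross-determined (inj₂ e) (inj₂ e′) with cong owners (trans (sym e) e′)
    ... | refl = inj₁ (refl , refl)

    module Selection (ptr : Fin m → Maybe (Fin m)) where

      choice : (u : Fin m) → Maybe (Fin m) → CV ⊎ Fin k
      choice u nothing = inj₁ (centre u)
      choice u (just t) with any? (isSpoke? u (L u t))
      ... | yes (i , _) = inj₂ i
      ... | no _ = inj₁ (part u (L u t))

      chosen : Fin m → CV ⊎ Fin k
      chosen u = choice u (ptr u)

      selected : List (CV ⊎ Fin k)
      selected = map chosen (allFin m)

      Aims : (u : Fin m) → Fin (parts P u) → Set
      Aims u A = Σ (Fin m) λ t → ptr u ≡ just t × L u t ≡ A

      PointsTo : Fin m → Fin m → Set
      PointsTo w u = ptr w ≡ just u × NoSpoke w (L w u)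

      SelfCovered : (u : Fin m) → Fin (parts P u) → Set
      SelfCovered u A = (ptr u ≡ nothing × NoSpoke u A) ⊎ Aims u A

      PartSupported : (u : Fin m) → Fin (parts P u) → Set
      PartSupported u A = ∀ w → _~_ T u w → L u w ≡ A → PointsTo w u

      SpokeCovered : (u : Fin m) → Fin (parts P u) → Set
      SpokeCovered u A = Aims u A ⊎ (ptr u ≡ nothing × PartSupported u A)

      CrossCovered : Fin m → Fin m → Set
      CrossCovered x y = SelfCovered x (L x y) × SelfCovered y (L y x) × (PointsTo y x ⊎ PointsTo x y)

      record Admissible : Set where
        field
          spokes-covered        : ∀ u A i → IsSpoke u A i → SpokeCovered u A
          crosses-covered       : ∀ x y i → IsCross x y i → CrossCovered x y
          other-parts-supported : ∀ u t A → ptr u ≡ just t → L u t ≢ A → PartSupported u A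

      cross-covered : ∀ {x y} → SelfCovered x (L x y) → PointsTo y x → CrossCovered x y
      cross-covered self y→x = self , inj₂ (_ , proj₁ y→x , refl) , inj₁ y→x

      CrossCovered-sym : ∀ {x y} → CrossCovered x y → CrossCovered y x
      CrossCovered-sym (self-x , self-y , inj₁ y→x) = self-y , self-x , inj₂ y→x
      CrossCovered-sym (self-x , self-y , inj₂ x→y) = self-y , self-x , inj₁ x→y

      CrossCovered-same-edge : ∀ {x y x′ y′ i} → IsCross x y i → IsCross x′ y′ i →
                               CrossCovered x′ y′ → CrossCovered x y
      CrossCovered-same-edge c c′ ok with cross-determined c c′
      ... | inj₁ (refl , refl) = ok
      ... | inj₂ (refl , refl) = CrossCovered-sym ok

      chosen-spec : ∀ u → (ptr u ≡ nothing × chosen u ≡ inj₁ (centre u)) ⊎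
                          Σ (Fin m) λ t → ptr u ≡ just t ×
                            ((Σ (Fin k) λ i → IsSpoke u (L u t) i × chosen u ≡ inj₂ i) ⊎
                             (NoSpoke u (L u t) × chosen u ≡ inj₁ (part u (L u t))))
      chosen-spec u with ptr u
      ... | nothing = inj₁ (refl , refl)
      ... | just t with any? (isSpoke? u (L u t))
      ...   | yes (i , spoke) = inj₂ (t , refl , inj₁ (i , spoke , refl))
      ...   | no no-spoke = inj₂ (t , refl , inj₂ ((λ i spoke → no-spoke (i , spoke)) , refl))

      just≢nothing : ∀ {t : Fin m} → just t ≢ nothing
      just≢nothing ()

      chosen-unaimed : ∀ {u} → ptr u ≡ nothing → chosen u ≡ inj₁ (centre u)
      chosen-unaimed {u} p with chosen-spec u
      ... | inj₁ (_ , e) = e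
      ... | inj₂ (_ , q , _) = ⊥-elim (just≢nothing (trans (sym q) p))

      chosen-aimed : ∀ {u t} → ptr u ≡ just t → NoSpoke u (L u t) → chosen u ≡ inj₁ (part u (L u t))
      chosen-aimed {u} p no-spoke with chosen-spec u
      ... | inj₁ (q , _) = ⊥-elim (just≢nothing (trans (sym p) q))
      ... | inj₂ (_ , q , rest) with trans (sym p) q
      ...   | refl with rest
      ...     | inj₁ (i , spoke , _) = ⊥-elim (no-spoke i spoke)
      ...     | inj₂ (_ , e) = e

      chosen∈ : ∀ u → chosen u ∈ selected
      chosen∈ u = ∈-map⁺ chosen (∈-allFin u)

      owner-chosen : ∀ u → owner′ (chosen u) ≡ u
      owner-chosen u with chosen-spec u
      ... | inj₁ (_ , e) = cong owner′ e
      ... | inj₂ (_ , _ , inj₁ (_ , spoke , e)) = trans (cong owner′ e) (owner-spoke spoke)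
      ... | inj₂ (_ , _ , inj₂ (_ , e)) = cong owner′ e

      selected-unique : Unique selected
      selected-unique = Unique.map⁺
        (λ {x} {y} e → trans (sym (owner-chosen x)) (trans (cong owner′ e) (owner-chosen y)))
        (Unique.allFin⁺ m)

      selected-length : length selected ≡ m
      selected-length = trans (length-map chosen (allFin m)) length-allFin

      module _ (valid : ValidEdgeFamily C es) (admissible : Admissible) where
        open Admissible admissible

        spoke-unique : ∀ {u A i j} → IsSpoke u A i → IsSpoke u A j → i ≡ j
        spoke-unique {i = i} {j} si sj with i ≟ j
        ... | yes i≡j = i≡j
        ... | no i≢j = ⊥-elim (clash si sj (proj₂ valid i j i≢j))
          where
          clash : IsSpoke _ _ i → IsSpoke _ _ j → es i ≢ es j × es i ≢ swap (es j) → ⊥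
          clash (inj₁ a) (inj₁ b) (ne , _) = ne (trans a (sym b))
          clash (inj₁ a) (inj₂ b) (_ , ne) = ne (trans a (sym (cong swap b)))
          clash (inj₂ a) (inj₁ b) (_ , ne) = ne (trans a (sym (cong swap b)))
          clash (inj₂ a) (inj₂ b) (ne , _) = ne (trans a (sym b))

        Covered : CV ⊎ Fin k → Set
        Covered z = z ∈ selected ⊎ (∃ λ x → x ∈ selected × SubdAdj C es x z)

        selected-at : ∀ {u z} → chosen u ≡ z → z ∈ selected
        selected-at {u} e = subst (_∈ selected) e (chosen∈ u)

        covered-from-neighbour : ∀ u w → _~_ T u w → PointsTo w u → ¬ SelfCovered u (L u w) →
                                 Covered (inj₁ (part u (L u w)))
        covered-from-neighbour u w u~w (ptr-w , no-spoke) not-self =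
          inj₂ (inj₁ (part w (L w u)) , selected-at (chosen-aimed ptr-w no-spoke) , (u~w , refl , refl) ,
                λ i → (λ e → not-self (proj₁ (crosses-covered u w i (inj₂ e))))
                    , (λ e → not-self (proj₁ (crosses-covered u w i (inj₁ e)))))

        covers-part : ∀ u A → Covered (inj₁ (part u A))
        covers-part u A with chosen-spec u
        ... | inj₁ (unaimed , e) with any? (isSpoke? u A)
        ...   | no no-spoke = inj₂ (inj₁ (centre u) , selected-at e , centre~part (λ i s → no-spoke (i , s)))
        ...   | yes (i , spoke) with spokes-covered u A i spoke
        ...     | inj₁ (_ , aimed , _) = ⊥-elim (just≢nothing (trans (sym aimed) unaimed))
        ...     | inj₂ (_ , supported) with nonempty P u A
        ...       | w , u~w , refl = covered-from-neighbour u w u~w (supported w u~w refl) λ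
                      { (inj₁ (_ , no-spoke)) → no-spoke i spoke
                      ; (inj₂ (_ , aimed , _)) → just≢nothing (trans (sym aimed) unaimed) }
        covers-part u A | inj₂ (t , aimed , rest) with L u t ≟ A
        covers-part u A | inj₂ (t , aimed , inj₁ (i , spoke , e)) | yes refl =
          inj₂ (inj₂ i , selected-at e , part~spoke spoke)
        covers-part u A | inj₂ (t , aimed , inj₂ (_ , e)) | yes refl = inj₁ (selected-at e)
        covers-part u A | inj₂ (t , aimed , _) | no other with nonempty P u A
        ... | w , u~w , refl =
          covered-from-neighbour u w u~w (other-parts-supported u t (L u w) aimed other w u~w refl) λ
            { (inj₁ (unaimed , _)) → just≢nothing (trans (sym aimed) unaimed)
            ; (inj₂ (t′ , aimed′ , same)) →
                other (subst (λ z → L u z ≡ L u w) (just-injective (trans (sym aimed′) aimed)) same) }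

        covers-centre : ∀ u → Covered (inj₁ (centre u))
        covers-centre u with chosen-spec u
        ... | inj₁ (_ , e) = inj₁ (selected-at e)
        ... | inj₂ (_ , _ , inj₁ (i , spoke , e)) = inj₂ (inj₂ i , selected-at e , centre~spoke spoke)
        ... | inj₂ (t , _ , inj₂ (no-spoke , e)) = inj₂ (inj₁ (part u (L u t)) , selected-at e , part~centre no-spoke)

        covers-spoke-vertex : ∀ {u A i} → IsSpoke u A i → Covered (inj₂ i)
        covers-spoke-vertex {u} {A} {i} spoke with spokes-covered u A i spoke
        ... | inj₂ (unaimed , _) = inj₂ (inj₁ (centre u) , selected-at (chosen-unaimed unaimed) , centre~spoke spoke)
        ... | inj₁ (t , aimed , refl) with chosen-spec u
        ...   | inj₁ (unaimed , _) = ⊥-elim (just≢nothing (trans (sym aimed) unaimed))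
        ...   | inj₂ (t′ , aimed′ , rest) with trans (sym aimed) aimed′
        ...     | refl with rest
        ...       | inj₂ (no-spoke , _) = ⊥-elim (no-spoke i spoke)
        ...       | inj₁ (j , spoke′ , e) with spoke-unique spoke spoke′
        ...         | refl = inj₁ (selected-at e)

        covers-subdivision-vertex : ∀ i (e : CV × CV) → es i ≡ e → CoronaAdj P (proj₁ e) (proj₂ e) →
                                    Covered (inj₂ i)
        covers-subdivision-vertex i (inj₁ v , inj₂ (w , A)) eq refl = covers-spoke-vertex (inj₁ eq)
        covers-subdivision-vertex i (inj₂ (w , A) , inj₁ v) eq refl = covers-spoke-vertex (inj₂ eq)
        covers-subdivision-vertex i (inj₂ (v , A) , inj₂ (u , B)) eq (_ , refl , refl)
          with proj₂ (proj₂ (crosses-covered v u i (inj₁ eq)))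
        ... | inj₁ (ptr-u , no-spoke) =
          inj₂ (inj₁ (part u (L u v)) , selected-at (chosen-aimed ptr-u no-spoke) , inj₂ (cong proj₂ eq))
        ... | inj₂ (ptr-v , no-spoke) =
          inj₂ (inj₁ (part v (L v u)) , selected-at (chosen-aimed ptr-v no-spoke) , inj₁ (cong proj₁ eq))

        selected-dominating : Dominating H selected
        selected-dominating (inj₁ (inj₁ u)) = covers-centre u
        selected-dominating (inj₁ (inj₂ (u , A))) = covers-part u A
        selected-dominating (inj₂ i) = covers-subdivision-vertex i (es i) refl (proj₁ valid i)

        γ-not-increased : ¬ DomIncreases C es
        γ-not-increased (a , b , ((D , uniq , dom , len) , _) , (_ , minimal) , a<b) =
          <⇒≱ a<b (≤-trans (subst (b ≤_) selected-length (minimal selected selected-unique selected-dominating))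
                           (subst (m ≤_) len (proj₂ γ-corona D uniq dom)))

-- A vertex off the a–b path points to its common parent,
-- a vertex strictly inside the path points nowhere, and the flags decide whether a points to
-- (the next vertex towards) b and b to a.
module TwoRootPointer {m : ℕ} (T : Graph (Fin m)) {n : Fin m → ℕ} (L : (v : Fin m) → Fin m → Fin (n v))
  (a b : Fin m) (Oa : Orientation T a) (Ob : Orientation T b) (flag-a flag-b : Bool) where

  open Orientation Oa using () renaming (parent to parentᵃ)
  open Orientation Ob using () renaming (parent to parentᵇ)

  pointer-elsewhere : (u : Fin m) → Dec (parentᵃ u ≡ parentᵇ u) → Maybe (Fin m)
  pointer-elsewhere u (yes _) = just (parentᵃ u)
  pointer-elsewhere u (no _) = nothing

  pointer-unless-b : (u : Fin m) → Dec (u ≡ b) → Maybe (Fin m)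
  pointer-unless-b u (yes _) = if flag-b then just (parentᵃ b) else nothing
  pointer-unless-b u (no _) = pointer-elsewhere u (parentᵃ u ≟ parentᵇ u)

  pointer-unless-a : (u : Fin m) → Dec (u ≡ a) → Maybe (Fin m)
  pointer-unless-a u (yes _) = if flag-a then just (parentᵇ a) else nothing
  pointer-unless-a u (no _) = pointer-unless-b u (u ≟ b)

  pointer : Fin m → Maybe (Fin m)
  pointer u = pointer-unless-a u (u ≟ a)

  pointer-a : pointer a ≡ (if flag-a then just (parentᵇ a) else nothing)
  pointer-a with a ≟ a
  ... | yes _ = refl
  ... | no a≢a = ⊥-elim (a≢a refl)

  pointer-b : b ≢ a → pointer b ≡ (if flag-b then just (parentᵃ b) else nothing)
  pointer-b b≢a with b ≟ a
  ... | yes b≡a = ⊥-elim (b≢a b≡a)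
  ... | no _ with b ≟ b
  ...   | yes _ = refl
  ...   | no b≢b = ⊥-elim (b≢b refl)

  pointer-other : ∀ {u} → u ≢ a → u ≢ b → parentᵃ u ≡ parentᵇ u → pointer u ≡ just (parentᵃ u)
  pointer-other {u} u≢a u≢b same with u ≟ a
  ... | yes u≡a = ⊥-elim (u≢a u≡a)
  ... | no _ with u ≟ b
  ...   | yes u≡b = ⊥-elim (u≢b u≡b)
  ...   | no _ with parentᵃ u ≟ parentᵇ u
  ...     | yes _ = refl
  ...     | no differ = ⊥-elim (differ same)

  data Pointed (u t : Fin m) : Set where
    is-a     : u ≡ a → flag-a ≡ true → t ≡ parentᵇ a → Pointed u t
    is-b     : u ≢ a → u ≡ b → flag-b ≡ true → t ≡ parentᵃ b → Pointed u t
    is-other : u ≢ a → u ≢ b → parentᵃ u ≡ parentᵇ u → t ≡ parentᵃ u → Pointed u t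

  if-just : ∀ (f : Bool) {x t : Fin m} → (if f then just x else nothing) ≡ just t → f ≡ true × t ≡ x
  if-just true refl = refl , refl

  pointed : ∀ {u t} → pointer u ≡ just t → Pointed u t
  pointed {u} e with u ≟ a
  ... | yes u≡a = is-a u≡a (proj₁ (if-just flag-a e)) (proj₂ (if-just flag-a e))
  ... | no u≢a with u ≟ b
  ...   | yes u≡b = is-b u≢a u≡b (proj₁ (if-just flag-b e)) (proj₂ (if-just flag-b e))
  ...   | no u≢b with parentᵃ u ≟ parentᵇ u
  ...     | yes same = is-other u≢a u≢b same (sym (just-injective e))
  pointed {u} () | no _ | no _ | no _

  Child : Fin m → Fin m → Set
  Child w u = pointer w ≡ just u × w ≢ a × w ≢ b

  child : ∀ {w u} → parentᵃ w ≡ u → parentᵇ w ≡ u → w ≢ a → w ≢ b → Child w u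
  child {w} pa pb w≢a w≢b =
    subst (λ z → pointer w ≡ just z) pa (pointer-other w≢a w≢b (trans pa (sym pb))) , w≢a , w≢b

  parent-of-neighbour-≢root : ∀ {r} (O : Orientation T r) {w u} → Orientation.parent O w ≡ u →
                              _~_ T u w → w ≢ r
  parent-of-neighbour-≢root O pw≡u u~w refl =
    ~⇒≢ T u~w (trans (sym pw≡u) (Orientation.parent-root O))

  parent-unless-pointed : ∀ {r} (O : Orientation T r) {u w t} → _~_ T u w → Orientation.parent O u ≡ t →
                          L u t ≢ L u w → Orientation.parent O w ≡ u
  parent-unless-pointed O u~w pu≡t other with Orientation.edge-oriented O u~w
  ... | inj₁ pu≡w = ⊥-elim (other (cong (L _) (trans (sym pu≡t) pu≡w)))
  ... | inj₂ pw≡u = pw≡u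

  child-of-both : ∀ {u w} → _~_ T u w → parentᵃ w ≡ u → parentᵇ w ≡ u → Child w u
  child-of-both u~w pa pb =
    child pa pb (parent-of-neighbour-≢root Oa pa u~w) (parent-of-neighbour-≢root Ob pb u~w)

  other-parts-children : ∀ {u t w} → pointer u ≡ just t → _~_ T u w → L u t ≢ L u w → Child w u
  other-parts-children {u} {t} {w} aimed u~w other with pointed {u} {t} aimed
  ... | is-a refl _ refl = child-of-both u~w (Orientation.parent-of-root-neighbour Oa u~w)
                                (parent-unless-pointed Ob u~w refl other)
  ... | is-b _ refl _ refl = child-of-both u~w (parent-unless-pointed Oa u~w refl other)
                               (Orientation.parent-of-root-neighbour Ob u~w)
  ... | is-other _ _ same refl = child-of-both u~w (parent-unless-pointed Oa u~w refl other)
                                    (parent-unless-pointed Ob u~w (sym same) other)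

  children-of-a : ∀ {w} → _~_ T a w → a ≡ b ⊎ L a (parentᵇ a) ≢ L a w → Child w a
  children-of-a a~w (inj₁ refl) = child-of-both a~w (Orientation.parent-of-root-neighbour Oa a~w)
                                    (Orientation.parent-of-root-neighbour Ob a~w)
  children-of-a a~w (inj₂ other) = child-of-both a~w (Orientation.parent-of-root-neighbour Oa a~w)
                                     (parent-unless-pointed Ob a~w refl other)

  children-of-b : ∀ {w} → _~_ T b w → L b (parentᵃ b) ≢ L b w → Child w b
  children-of-b b~w other = child-of-both b~w (parent-unless-pointed Oa b~w refl other)
                              (Orientation.parent-of-root-neighbour Ob b~w)

module FewSubdivisions {m : ℕ} (T : Graph (Fin m)) (tree : IsTree T) (P : NbhdPartition T)
  {k : ℕ} (es : Fin k → CoronaV P × CoronaV P) (valid : ValidEdgeFamily (corona T P) es) where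

  open Corona T P
  open Subdivided es
  open Tree T tree using (orientation; parent-towards; parent-towards-neighbour)

  module Rooted (a b : Fin m) (flag-a flag-b : Bool) where
    open TwoRootPointer T L a b (orientation a) (orientation b) flag-a flag-b public
    open Selection pointer public

    SpokesAtRoots : Set
    SpokesAtRoots = ∀ u A i → IsSpoke u A i → u ≡ a ⊎ u ≡ b

    -- A subdivided spoke at a root is dominated from the root aiming at its part (flag on),
    -- or from the children lying in that part (flag off).
    SpokesAtA : Set
    SpokesAtA = ∀ A i → IsSpoke a A i →
      (flag-a ≡ true × L a (parent-towards b a) ≡ A) ⊎ (flag-a ≡ false × (a ≡ b ⊎ L a (parent-towards b a) ≢ A))

    SpokesAtB : Set
    SpokesAtB = ∀ B i → IsSpoke b B i → b ≢ a →
      (flag-b ≡ true × L b (parent-towards a b) ≡ B) ⊎ (flag-b ≡ false × L b (parent-towards a b) ≢ B)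

    CrossesCovered : Set
    CrossesCovered = ∀ x y i → IsCross x y i → CrossCovered x y

    module _ (spokes-at-roots : SpokesAtRoots) (spokes-at-a : SpokesAtA) (spokes-at-b : SpokesAtB) where

      no-spoke-off-roots : ∀ w B → w ≢ a → w ≢ b → NoSpoke w B
      no-spoke-off-roots w B w≢a w≢b i spoke with spokes-at-roots w B i spoke
      ... | inj₁ w≡a = w≢a w≡a
      ... | inj₂ w≡b = w≢b w≡b

      child-points : ∀ {w u} → Child w u → PointsTo w u
      child-points (aimed , w≢a , w≢b) = aimed , no-spoke-off-roots _ _ w≢a w≢b

      if-true : ∀ {f : Bool} {x : Fin m} → f ≡ true → (if f then just x else nothing) ≡ just x
      if-true refl = refl

      if-false : ∀ {f : Bool} {x : Fin m} → f ≡ false → (if f then just x else nothing) ≡ nothing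
      if-false refl = refl

      spoke-at-a-covered : ∀ A i → IsSpoke a A i → SpokeCovered a A
      spoke-at-a-covered A i spoke with spokes-at-a A i spoke
      ... | inj₁ (on , aims) = inj₁ (_ , trans pointer-a (if-true on) , aims)
      ... | inj₂ (off , other) = inj₂ (trans pointer-a (if-false off) ,
              λ w a~w w∈A → child-points (children-of-a a~w (⊎-map₂ (λ ne e → ne (trans e w∈A)) other)))

      spoke-at-b-covered : Dec (b ≡ a) → ∀ B i → IsSpoke b B i → SpokeCovered b B
      spoke-at-b-covered (yes refl) = spoke-at-a-covered
      spoke-at-b-covered (no b≢a) B i spoke with spokes-at-b B i spoke b≢a
      ... | inj₁ (on , aims) = inj₁ (_ , trans (pointer-b b≢a) (if-true on) , aims)
      ... | inj₂ (off , other) = inj₂ (trans (pointer-b b≢a) (if-false off) ,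
              λ w b~w w∈B → child-points (children-of-b b~w (λ e → other (trans e w∈B))))

      spokes-covered : ∀ u A i → IsSpoke u A i → SpokeCovered u A
      spokes-covered u A i spoke with spokes-at-roots u A i spoke
      ... | inj₁ refl = spoke-at-a-covered A i spoke
      ... | inj₂ refl = spoke-at-b-covered (b ≟ a) A i spoke

      γ-kept : CrossesCovered → ¬ DomIncreases C es
      γ-kept crosses-covered = γ-not-increased valid record
        { spokes-covered = spokes-covered
        ; crosses-covered = crosses-covered
        ; other-parts-supported = λ u t A aimed other w u~w w∈A →
            child-points (other-parts-children aimed u~w (λ e → other (trans e w∈A))) }

  flag-spec : ∀ {X : Set} (d : Dec X) → (does d ≡ true × X) ⊎ (does d ≡ false × ¬ X)
  flag-spec (yes x) = inj₁ (refl , x)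
  flag-spec (no ¬x) = inj₂ (refl , ¬x)

  parent-of-neighbour : ∀ {r w} → _~_ T r w → parent-towards r w ≡ r
  parent-of-neighbour {r} = Orientation.parent-of-root-neighbour (orientation r)

  γ-kept-single-root : ∀ r → (∀ u A i → IsSpoke u A i → u ≡ r) →
                       Rooted.CrossesCovered r r false false → ¬ DomIncreases C es
  γ-kept-single-root r spokes-at-r = Rooted.γ-kept r r false false
    (λ u A i spoke → inj₁ (spokes-at-r u A i spoke))
    (λ _ _ _ → inj₂ (refl , inj₁ refl))
    (λ _ _ _ r≢r → ⊥-elim (r≢r refl))

  module _ (r : Fin m) where
    open Rooted r r false false

    points-to-single-root : ∀ {w} → _~_ T r w → (∀ B → NoSpoke w B) → PointsTo w r
    points-to-single-root r~w no-spoke =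
      proj₁ (child-of-both r~w (parent-of-neighbour r~w) (parent-of-neighbour r~w)) , no-spoke _

  only-spokes : ∀ {u A v B} → (∀ i → IsSpoke u A i ⊎ IsSpoke v B i) → ∀ {x y i} → ¬ IsCross x y i
  only-spokes only {i = i} c = [ (λ s → spoke≢cross s c) , (λ s → spoke≢cross s c) ]′ (only i)

  two-spokes : ∀ u A v B → (∀ i → IsSpoke u A i ⊎ IsSpoke v B i) → ¬ DomIncreases C es
  two-spokes u A v B only with u ≟ v
  ... | yes refl = γ-kept-single-root u (λ _ _ i s → [ spoke-centre-unique s , spoke-centre-unique s ]′ (only i))
                     (λ _ _ _ c → ⊥-elim (only-spokes only c))
  ... | no u≢v = γ-kept at-roots at-u at-v (λ _ _ _ c → ⊥-elim (only-spokes only c))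
    where
    aims-u : Dec (L u (parent-towards v u) ≡ A)
    aims-u = L u (parent-towards v u) ≟ A

    aims-v : Dec (L v (parent-towards u v) ≡ B)
    aims-v = L v (parent-towards u v) ≟ B

    open Rooted u v (does aims-u) (does aims-v)

    at-roots : SpokesAtRoots
    at-roots _ _ i s = ⊎-map (spoke-centre-unique s) (spoke-centre-unique s) (only i)

    at-u : SpokesAtA
    at-u A′ i s with only i
    ... | inj₂ s′ = ⊥-elim (u≢v (spoke-centre-unique s s′))
    ... | inj₁ s′ with spoke-determined s s′
    ...   | refl = ⊎-map₂ (λ (off , ¬aims) → off , inj₂ ¬aims) (flag-spec aims-u)

    at-v : SpokesAtB
    at-v B′ i s _ with only i
    ... | inj₁ s′ = ⊥-elim (u≢v (sym (spoke-centre-unique s s′)))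
    ... | inj₂ s′ with spoke-determined s s′
    ...   | refl = flag-spec aims-v

  spoke-and-incident-cross : ∀ u A y → _~_ T u y → (∀ i → IsSpoke u A i ⊎ IsCross u y i) → ¬ DomIncreases C es
  spoke-and-incident-cross u A y u~y only with L u y ≟ A
  ... | yes y∈A = γ-kept at-roots at-u at-y crosses
    where
    open Rooted u y true true

    y≢u : y ≢ u
    y≢u = ~⇒≢ T (~-sym T u~y)

    at-roots : SpokesAtRoots
    at-roots _ _ i s = inj₁ ([ spoke-centre-unique s , (λ c → ⊥-elim (spoke≢cross s c)) ]′ (only i))

    at-u : SpokesAtA
    at-u A′ i s with only i
    ... | inj₂ c = ⊥-elim (spoke≢cross s c)
    ... | inj₁ s′ with spoke-determined s s′
    ...   | refl = inj₁ (refl , trans (cong (L u) (parent-of-neighbour (~-sym T u~y))) y∈A)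

    at-y : SpokesAtB
    at-y B′ i s _ with only i
    ... | inj₁ s′ = ⊥-elim (y≢u (spoke-centre-unique s s′))
    ... | inj₂ c = ⊥-elim (spoke≢cross s c)

    no-spoke-y : ∀ B → NoSpoke y B
    no-spoke-y B i s = [ (λ s′ → y≢u (spoke-centre-unique s s′)) , spoke≢cross s ]′ (only i)

    crosses : CrossesCovered
    crosses _ _ i c with only i
    ... | inj₁ s = ⊥-elim (spoke≢cross s c)
    ... | inj₂ c′ = CrossCovered-same-edge c c′ (cross-covered
          (inj₂ (y , trans pointer-a (cong just (parent-of-neighbour (~-sym T u~y))) , refl))
          (trans (pointer-b y≢u) (cong just (parent-of-neighbour u~y)) , no-spoke-y _))
  ... | no y∉A = γ-kept-single-root u at-u crosses
    where
    open Rooted u u false false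

    y≢u : y ≢ u
    y≢u = ~⇒≢ T (~-sym T u~y)

    at-u : ∀ u′ A′ i → IsSpoke u′ A′ i → u′ ≡ u
    at-u _ _ i s = [ spoke-centre-unique s , (λ c → ⊥-elim (spoke≢cross s c)) ]′ (only i)

    no-spoke-y : ∀ B → NoSpoke y B
    no-spoke-y B i s = y≢u (at-u _ _ i s)

    no-spoke-u : NoSpoke u (L u y)
    no-spoke-u i s with only i
    ... | inj₂ c = spoke≢cross s c
    ... | inj₁ s′ with spoke-determined s s′
    ...   | refl = y∉A refl

    crosses : CrossesCovered
    crosses _ _ i c with only i
    ... | inj₁ s = ⊥-elim (spoke≢cross s c)
    ... | inj₂ c′ = CrossCovered-same-edge c c′
          (cross-covered (inj₁ (pointer-a , no-spoke-u)) (points-to-single-root u u~y no-spoke-y))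

  -- c lies beyond b as seen from u.
  spoke-and-distant-cross : ∀ u A b c → _~_ T b c → parent-towards u c ≡ b → u ≢ b → u ≢ c →
                            (∀ i → IsSpoke u A i ⊎ IsCross b c i) → ¬ DomIncreases C es
  spoke-and-distant-cross u A b c b~c c→b u≢b u≢c only = γ-kept at-roots at-u at-b crosses
    where
    aims-u : Dec (L u (parent-towards b u) ≡ A)
    aims-u = L u (parent-towards b u) ≟ A

    open Rooted u b (does aims-u) false

    at-u′ : ∀ u′ A′ i → IsSpoke u′ A′ i → u′ ≡ u
    at-u′ _ _ i s = [ spoke-centre-unique s , (λ c → ⊥-elim (spoke≢cross s c)) ]′ (only i)

    at-roots : SpokesAtRoots
    at-roots u′ A′ i s = inj₁ (at-u′ u′ A′ i s)

    at-u : SpokesAtA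
    at-u A′ i s with only i
    ... | inj₂ c = ⊥-elim (spoke≢cross s c)
    ... | inj₁ s′ with spoke-determined s s′
    ...   | refl = ⊎-map₂ (λ (off , ¬aims) → off , inj₂ ¬aims) (flag-spec aims-u)

    at-b : SpokesAtB
    at-b B′ i s b≢u = ⊥-elim (b≢u (at-u′ _ _ i s))

    no-spoke-off-u : ∀ w B → w ≢ u → NoSpoke w B
    no-spoke-off-u w B w≢u i s = w≢u (at-u′ w B i s)

    c-points-to-b : pointer c ≡ just b
    c-points-to-b = trans (pointer-other (λ e → u≢c (sym e)) (~⇒≢ T (~-sym T b~c))
                                         (trans c→b (sym (parent-of-neighbour b~c))))
                          (cong just c→b)

    crosses : CrossesCovered
    crosses _ _ i c′ with only i
    ... | inj₁ s = ⊥-elim (spoke≢cross s c′)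
    ... | inj₂ c″ = CrossCovered-same-edge c′ c″ (cross-covered
          (inj₁ (pointer-b (λ e → u≢b (sym e)) , no-spoke-off-u b _ (λ e → u≢b (sym e))))
          (c-points-to-b , no-spoke-off-u c _ (λ e → u≢c (sym e))))

  spoke-and-cross : ∀ u A x y → _~_ T x y → (∀ i → IsSpoke u A i ⊎ IsCross x y i) → ¬ DomIncreases C es
  spoke-and-cross u A x y x~y only with u ≟ x | u ≟ y
  ... | yes refl | _ = spoke-and-incident-cross u A y x~y only
  ... | no _ | yes refl = spoke-and-incident-cross u A x (~-sym T x~y) (λ i → ⊎-map₂ cross-sym (only i))
  ... | no u≢x | no u≢y with Orientation.edge-oriented (orientation u) x~y
  ...   | inj₂ y→x = spoke-and-distant-cross u A x y x~y y→x u≢x u≢y only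
  ...   | inj₁ x→y = spoke-and-distant-cross u A y x (~-sym T x~y) x→y u≢y u≢x (λ i → ⊎-map₂ cross-sym (only i))

  only-crosses : ∀ {x y z w} → (∀ i → IsCross x y i ⊎ IsCross z w i) → ∀ u A i → ¬ IsSpoke u A i
  only-crosses only _ _ i s = [ spoke≢cross s , spoke≢cross s ]′ (only i)

  crosses-sharing-vertex : ∀ s c₁ c₂ → _~_ T s c₁ → _~_ T s c₂ →
                           (∀ i → IsCross s c₁ i ⊎ IsCross s c₂ i) → ¬ DomIncreases C es
  crosses-sharing-vertex s c₁ c₂ s~c₁ s~c₂ only =
    γ-kept-single-root s (λ u A i sp → ⊥-elim (only-crosses only u A i sp)) crosses
    where
    open Rooted s s false false

    covered : ∀ c → _~_ T s c → CrossCovered s c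
    covered c s~c = cross-covered (inj₁ (pointer-a , only-crosses only s _))
                                  (points-to-single-root s s~c (only-crosses only c))

    crosses : CrossesCovered
    crosses _ _ i c with only i
    ... | inj₁ c′ = CrossCovered-same-edge c c′ (covered c₁ s~c₁)
    ... | inj₂ c′ = CrossCovered-same-edge c c′ (covered c₂ s~c₂)

  -- c₁ lies beyond a as seen from b, and c₂ beyond b as seen from a.
  crosses-apart : ∀ a c₁ b c₂ → _~_ T a c₁ → _~_ T b c₂ →
                  parent-towards b c₁ ≡ a → parent-towards a c₂ ≡ b → a ≢ b → c₁ ≢ b → c₂ ≢ a → (∀ i → IsCross a c₁ i ⊎ IsCross b c₂ i) → ¬ DomIncreases C es
  crosses-apart a c₁ b c₂ a~c₁ b~c₂ c₁→a c₂→b a≢b c₁≢b c₂≢a only =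
    γ-kept (λ u A i sp → ⊥-elim (no-spoke u A i sp)) (λ A i sp → ⊥-elim (no-spoke a A i sp))
           (λ B i sp _ → ⊥-elim (no-spoke b B i sp)) crosses
    where
    open Rooted a b false false

    no-spoke : ∀ u A → NoSpoke u A
    no-spoke = only-crosses only

    c₁-points-to-a : pointer c₁ ≡ just a
    c₁-points-to-a = trans (pointer-other (~⇒≢ T (~-sym T a~c₁)) c₁≢b
                                          (trans (parent-of-neighbour a~c₁) (sym c₁→a)))
                           (cong just (parent-of-neighbour a~c₁))

    c₂-points-to-b : pointer c₂ ≡ just b
    c₂-points-to-b = trans (pointer-other c₂≢a (~⇒≢ T (~-sym T b~c₂))
                                          (trans c₂→b (sym (parent-of-neighbour b~c₂))))
                           (cong just c₂→b)

    crosses : CrossesCovered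
    crosses _ _ i c with only i
    ... | inj₁ c′ = CrossCovered-same-edge c c′
          (cross-covered (inj₁ (pointer-a , no-spoke a _)) (c₁-points-to-a , no-spoke c₁ _))
    ... | inj₂ c′ = CrossCovered-same-edge c c′
          (cross-covered (inj₁ (pointer-b (λ e → a≢b (sym e)) , no-spoke b _)) (c₂-points-to-b , no-spoke c₂ _))

  -- Orienting z w towards a puts one of z, w on the far side; the parent of c₁ towards it is still a.
  crosses-one-side : ∀ a c₁ z w → _~_ T a c₁ → _~_ T z w → parent-towards z c₁ ≡ a →
                     a ≢ z → a ≢ w → c₁ ≢ z → c₁ ≢ w →
                     (∀ i → IsCross a c₁ i ⊎ IsCross z w i) → ¬ DomIncreases C es
  crosses-one-side a c₁ z w a~c₁ z~w c₁→a a≢z a≢w c₁≢z c₁≢w only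
    with Orientation.edge-oriented (orientation a) z~w
  ... | inj₂ w→z = crosses-apart a c₁ z w a~c₁ z~w c₁→a w→z a≢z c₁≢z (λ e → a≢w (sym e)) only
  ... | inj₁ z→w = crosses-apart a c₁ w z a~c₁ (~-sym T z~w)
        (trans (sym (parent-towards-neighbour z~w c₁≢z c₁≢w)) c₁→a) z→w a≢w c₁≢w (λ e → a≢z (sym e))
        (λ i → ⊎-map₂ cross-sym (only i))

  two-crosses : ∀ x y z w → _~_ T x y → _~_ T z w → (∀ i → IsCross x y i ⊎ IsCross z w i) →
                ¬ DomIncreases C es
  two-crosses x y z w x~y z~w only with x ≟ z
  ... | yes refl = crosses-sharing-vertex x y w x~y z~w only
  ... | no x≢z with x ≟ w
  ...   | yes refl = crosses-sharing-vertex x y z x~y (~-sym T z~w) (λ i → ⊎-map₂ cross-sym (only i))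
  ...   | no x≢w with y ≟ z
  ...     | yes refl = crosses-sharing-vertex y x w (~-sym T x~y) z~w (λ i → ⊎-map₁ cross-sym (only i))
  ...     | no y≢z with y ≟ w
  ...       | yes refl = crosses-sharing-vertex y x z (~-sym T x~y) (~-sym T z~w)
                           (λ i → ⊎-map cross-sym cross-sym (only i))
  ...       | no y≢w with Orientation.edge-oriented (orientation z) x~y
  ...         | inj₂ y→x = crosses-one-side x y z w x~y z~w y→x x≢z x≢w y≢z y≢w only
  ...         | inj₁ x→y = crosses-one-side y x z w (~-sym T x~y) z~w x→y y≢z y≢w x≢z x≢w
                             (λ i → ⊎-map₁ cross-sym (only i))

  data EdgeKind (i : Fin k) : Set where
    spoke : ∀ u A → IsSpoke u A i → EdgeKind i
    cross : ∀ x y → _~_ T x y → IsCross x y i → EdgeKind i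

  classify : ∀ i → EdgeKind i
  classify i = from-edge (es i) refl (proj₁ valid i)
    where
    from-edge : ∀ e → es i ≡ e → CoronaAdj P (proj₁ e) (proj₂ e) → EdgeKind i
    from-edge (inj₁ v , inj₂ (w , A)) eq refl = spoke w A (inj₁ eq)
    from-edge (inj₂ (w , A) , inj₁ v) eq refl = spoke w A (inj₂ eq)
    from-edge (inj₂ (v , A) , inj₂ (u , B)) eq (u~v , refl , refl) = cross v u (~-sym T u~v) (inj₁ eq)

  -- Covers k = 1 (with i = j) and k = 2.
  pair-keeps-γ : ∀ i j → (∀ l → l ≡ i ⊎ l ≡ j) → ¬ DomIncreases C es
  pair-keeps-γ i j i-or-j = by-kinds (classify i) (classify j)
    where
    either : ∀ {E F : Fin k → Set} → E i → F j → ∀ l → E l ⊎ F l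
    either e f l = ⊎-map (λ { refl → e }) (λ { refl → f }) (i-or-j l)

    by-kinds : EdgeKind i → EdgeKind j → ¬ DomIncreases C es
    by-kinds (spoke u A s) (spoke v B s′) = two-spokes u A v B (either s s′)
    by-kinds (spoke u A s) (cross x y x~y c) = spoke-and-cross u A x y x~y (either s c)
    by-kinds (cross x y x~y c) (spoke u A s) = spoke-and-cross u A x y x~y (λ l → ⊎-swap (either c s l))
    by-kinds (cross x y x~y c) (cross z w z~w c′) = two-crosses x y z w x~y z~w (either c c′)

  no-edges-keep-γ : ¬ Fin k → ¬ DomIncreases C es
  no-edges-keep-γ no-edge = γ-not-increased valid record
    { spokes-covered = λ _ _ i → ⊥-elim (no-edge i)
    ; crosses-covered = λ _ _ i → ⊥-elim (no-edge i)
    ; other-parts-supported = λ _ _ _ () }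
    where open Selection (λ _ → nothing)

at-most-two-subdivisions-keep-γ : ∀ {m} (T : Graph (Fin m)) → IsTree T → (P : NbhdPartition T) →
  ∀ k → k < 3 → (es : Fin k → CoronaV P × CoronaV P) → ValidEdgeFamily (corona T P) es →
  ¬ DomIncreases (corona T P) es
at-most-two-subdivisions-keep-γ T tree P 0 _ es valid = FewSubdivisions.no-edges-keep-γ T tree P es valid λ ()
at-most-two-subdivisions-keep-γ T tree P 1 _ es valid =
  FewSubdivisions.pair-keeps-γ T tree P es valid f0 f0 λ { f0 → inj₁ refl }
at-most-two-subdivisions-keep-γ T tree P 2 _ es valid =
  FewSubdivisions.pair-keeps-γ T tree P es valid f0 (fs f0) λ { f0 → inj₁ refl ; (fs f0) → inj₂ refl }
at-most-two-subdivisions-keep-γ T tree P (suc (suc (suc _))) (s≤s (s≤s (s≤s ()))) es valid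

-- Subdividing the three edges of the path (u,1) (u,B) (v,A) (v,1), where B ∋ v and A ∋ u.
module PathSubdivision {m : ℕ} (T : Graph (Fin m)) (P : NbhdPartition T) (u v : Fin m) (u~v : _~_ T u v) where
  open Corona T P

  X Y : CV
  X = part u (L u v)
  Y = part v (L v u)

  path-edges : Fin 3 → CV × CV
  path-edges f0 = centre u , X
  path-edges (fs f0) = X , Y
  path-edges (fs (fs f0)) = Y , centre v

  path-edges-valid : ValidEdgeFamily C path-edges
  path-edges-valid = edges , distinct
    where
    u≢v : u ≢ v
    u≢v = ~⇒≢ T u~v

    edges : ∀ i → _~_ C (proj₁ (path-edges i)) (proj₂ (path-edges i))
    edges f0 = refl
    edges (fs f0) = ~-sym T u~v , refl , refl
    edges (fs (fs f0)) = refl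

    distinct : ∀ i j → i ≢ j → path-edges i ≢ path-edges j × path-edges i ≢ swap (path-edges j)
    distinct f0 f0 i≢i = ⊥-elim (i≢i refl)
    distinct f0 (fs f0) _ = (λ ()) , (λ ())
    distinct f0 (fs (fs f0)) _ = (λ ()) , (λ { refl → u≢v refl })
    distinct (fs f0) f0 _ = (λ ()) , (λ ())
    distinct (fs f0) (fs f0) i≢i = ⊥-elim (i≢i refl)
    distinct (fs f0) (fs (fs f0)) _ = (λ ()) , (λ ())
    distinct (fs (fs f0)) f0 _ = (λ ()) , (λ { refl → u≢v refl })
    distinct (fs (fs f0)) (fs f0) _ = (λ ()) , (λ ())
    distinct (fs (fs f0)) (fs (fs f0)) i≢i = ⊥-elim (i≢i refl)

  open Subdivided path-edges

  -- Class 0 is {X, middle subdivision vertex, Y}; every other vertex is in the class of its owner.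
  -- A dominating set must meet the closed neighbourhood of the middle subdivision vertex (inside class 0)
  -- and that of each centre w (inside class w).
  class-of-part : (w : Fin m) (A : Fin (parts P w)) → Dec (part w A ≡ X) → Dec (part w A ≡ Y) → Fin (suc m)
  class-of-part w A (yes _) _ = f0
  class-of-part w A (no _) (yes _) = f0
  class-of-part w A (no _) (no _) = fs w

  class : CV ⊎ Fin 3 → Fin (suc m)
  class (inj₁ (inj₁ w)) = fs w
  class (inj₁ (inj₂ (w , A))) = class-of-part w A (part w A ≟ᶜ X) (part w A ≟ᶜ Y)
  class (inj₂ f0) = fs u
  class (inj₂ (fs f0)) = f0
  class (inj₂ (fs (fs f0))) = fs v

  class-X : class (inj₁ X) ≡ f0
  class-X with X ≟ᶜ X
  ... | yes _ = refl
  ... | no X≢X = ⊥-elim (X≢X refl)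

  class-Y : class (inj₁ Y) ≡ f0
  class-Y with Y ≟ᶜ X
  ... | yes _ = refl
  ... | no _ with Y ≟ᶜ Y
  ...   | yes _ = refl
  ...   | no Y≢Y = ⊥-elim (Y≢Y refl)

  dominating-≥ : ∀ D → Unique D → Dominating H D → suc m ≤ length D
  dominating-≥ D _ dom = onto⇒≤length class D meets
    where
    meets : ∀ j → ∃ λ x → x ∈ D × class x ≡ j
    meets f0 with dom (inj₂ (fs f0))
    ... | inj₁ x∈D = _ , x∈D , refl
    ... | inj₂ (inj₁ _ , x∈D , inj₁ refl) = _ , x∈D , class-X
    ... | inj₂ (inj₁ _ , x∈D , inj₂ refl) = _ , x∈D , class-Y
    meets (fs w) with dom (inj₁ (centre w))
    ... | inj₁ x∈D = _ , x∈D , refl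
    ... | inj₂ (inj₂ f0 , x∈D , inj₁ refl) = _ , x∈D , refl
    ... | inj₂ (inj₂ (fs f0) , x∈D , inj₁ ())
    ... | inj₂ (inj₂ (fs f0) , x∈D , inj₂ ())
    ... | inj₂ (inj₂ (fs (fs f0)) , x∈D , inj₂ refl) = _ , x∈D , refl
    ... | inj₂ (inj₁ (inj₂ (w , A)) , x∈D , refl , kept) = _ , x∈D , off-path (part w A ≟ᶜ X) (part w A ≟ᶜ Y)
      where
      off-path : (dX : Dec (part w A ≡ X)) (dY : Dec (part w A ≡ Y)) → class-of-part w A dX dY ≡ fs w
      off-path (yes refl) _ = ⊥-elim (proj₂ (kept f0) refl)
      off-path (no _) (yes refl) = ⊥-elim (proj₁ (kept (fs (fs f0))) refl)
      off-path (no _) (no _) = refl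

  centres-and-middle : List (CV ⊎ Fin 3)
  centres-and-middle = inj₂ (fs f0) ∷ map (inj₁ ∘′ centre) (allFin m)

  centres-and-middle-unique : Unique centres-and-middle
  centres-and-middle-unique = ∉⇒All≢ middle∉ ∷ Unique.map⁺ (λ { refl → refl }) (Unique.allFin⁺ m)
    where
    middle∉ : inj₂ (fs f0) ∉ map (inj₁ ∘′ centre) (allFin m)
    middle∉ x∈ with ∈-map⁻ (inj₁ ∘′ centre) x∈
    ... | _ , _ , ()

  centre∈ : ∀ w → inj₁ (centre w) ∈ centres-and-middle
  centre∈ w = there (∈-map⁺ (inj₁ ∘′ centre) (∈-allFin w))

  centres-and-middle-dominating : Dominating H centres-and-middle
  centres-and-middle-dominating (inj₁ (inj₁ w)) = inj₁ (centre∈ w)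
  centres-and-middle-dominating (inj₁ (inj₂ (w , A))) with part w A ≟ᶜ X | part w A ≟ᶜ Y
  ... | yes e | _ = inj₂ (inj₂ (fs f0) , here refl , inj₁ (sym e))
  ... | no _ | yes e = inj₂ (inj₂ (fs f0) , here refl , inj₂ (sym e))
  ... | no ≢X | no ≢Y = inj₂ (inj₁ (centre w) , centre∈ w , refl , kept)
    where
    kept : ∀ i → path-edges i ≢ (centre w , part w A) × path-edges i ≢ (part w A , centre w)
    kept f0 = (λ { refl → ≢X refl }) , (λ ())
    kept (fs f0) = (λ ()) , (λ ())
    kept (fs (fs f0)) = (λ ()) , (λ { refl → ≢Y refl })
  centres-and-middle-dominating (inj₂ f0) = inj₂ (inj₁ (centre u) , centre∈ u , inj₁ refl)
  centres-and-middle-dominating (inj₂ (fs f0)) = inj₁ (here refl)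
  centres-and-middle-dominating (inj₂ (fs (fs f0))) = inj₂ (inj₁ (centre v) , centre∈ v , inj₂ refl)

  γ-path-subdivided : IsDomNumber H (suc m)
  γ-path-subdivided =
    (centres-and-middle , centres-and-middle-unique , centres-and-middle-dominating ,
     cong suc (trans (length-map _ (allFin m)) length-allFin)) ,
    dominating-≥

  path-subdivision-increases : DomIncreases C path-edges
  path-subdivision-increases = m , suc m , γ-corona , γ-path-subdivided , n<1+n m

sd-corona : ∀ {m} (T : Graph (Fin m)) → IsTree T → (P : NbhdPartition T) →
            ∀ {u v} → _~_ T u v → IsSdNumber (corona T P) 3
sd-corona T tree P {u} {v} u~v =
  (path-edges , path-edges-valid , path-subdivision-increases) , at-most-two-subdivisions-keep-γ T tree P
  where open PathSubdivision T P u v u~v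

part-edge : ∀ {m} {T : Graph (Fin m)} (P : NbhdPartition T) (v : Fin m) → Fin (parts P v) →
            ∃ λ u → ∃ λ w → _~_ T u w
part-edge P v A = v , proj₁ (nonempty P v A) , proj₁ (proj₂ (nonempty P v A))

-- Two distinct vertices of the corona have different owners, or one of them is a part (v,A),
-- which contains a neighbour of v.
corona-edge : ∀ {m} (T : Graph (Fin m)) → IsTree T → (P : NbhdPartition T) →
              (x y : CoronaV P) → x ≢ y → ∃ λ u → ∃ λ v → _~_ T u v
corona-edge T tree P x y x≢y with Corona.owner T P x ≟ Corona.owner T P y
... | no owners≢ = first-step owners≢ (proj₁ tree _ _)
  where
  first-step : ∀ {u v} → u ≢ v → Reach T u v → ∃ λ u → ∃ λ v → _~_ T u v
  first-step u≢v here = ⊥-elim (u≢v refl)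
  first-step _ (step u~w _) = _ , _ , u~w
corona-edge T tree P (inj₂ (v , A)) y x≢y | yes _ = part-edge P v A
corona-edge T tree P (inj₁ v) (inj₂ (v′ , A)) x≢y | yes _ = part-edge P v′ A
corona-edge T tree P (inj₁ v) (inj₁ v′) x≢y | yes v≡v′ = ⊥-elim (x≢y (cong inj₁ v≡v′))

lemma1 : (n : ℕ) (T : Graph (Fin n)) → 3 ≤ n → IsTree T →
    (m : ℕ) (T′ : Graph (Fin m)) → IsTree T′ → (P : NbhdPartition T′) →
    T ≅ corona T′ P →
    IsSdNumber T 3
lemma1 (suc (suc _)) T (s≤s (s≤s _)) _ m T′ tree′ P T≅corona =
  IsSdNumber-transport iso (sd-corona T′ tree′ P (proj₂ (proj₂ edge)))
  where
  iso : Iso T (corona T′ P)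
  iso = ≅⇒Iso T≅corona

  edge : ∃ λ u → ∃ λ v → _~_ T′ u v
  edge = corona-edge T′ tree′ P (to iso f0) (to iso (fs f0)) (λ e → case (to-injective iso e))
    where case : f0 ≢ fs f0
          case ()
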